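{- Let $d\ge1$ and consider the rotor-router growth model on $\mathbb{Z}^d$ with a total ordering of $E_d=\{\pm e_1,\dots,\pm e_d\}$ satisfying (i) $e_1<e_2<\dots<e_d$ and (ii) $e_i<-e_i$ for $i=1,\dots,d$. For every $n\ge1$, let $c=(c_1,\dots,c_d)$ be the center of mass (average position) of the set of occupied sites after $n$ particles have been deposited and allowed to equilibrate. Then $0\le c_i\le 1$ for all $i$. Moreover, if $C\subset\{1,\dots,d\}$ is a coclique, then $\sum_{i\in C}c_i\le 1$.
   Context: Write the ordering as $\epsilon_0<\epsilon_1<\dots<\epsilon_{2d-1}$. Each occupied site carries a rotor pointing in one of the directions $\epsilon_j$. The growth process starts with no sites occupied; each particle is placed at the origin, and while it is at an occupied site $x$ it moves to $x+(\text{rotor direction at }x)$ and the rotor at $x$ is then advanced to the next direction in the cyclic order $\epsilon_0\to\epsilon_1\to\dots\to\epsilon_{2d-1}\to\epsilon_0$; when it reaches an unoccupied site it stops there, and that site becomes occupied with rotor $\epsilon_0$ (in particular the first particle occupies the origin). A set $C\subset\{1,\dots,d\}$ is a coclique if the sets $\{\epsilon\in E_d: e_i<\epsilon\le -e_i\}$, $i\in C$, are pairwise disjoint. -}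

module Defs where

open import Data.Nat as ℕ using (ℕ; zero; suc; _*_)
open import Data.Integer as ℤ using (ℤ; +_; -[1+_])
open import Data.Rational as ℚ using (ℚ; 0ℚ)
open import Data.Fin as Fin using (Fin; zero; suc; toℕ; fromℕ<)
open import Data.Fin.Subset using (Subset)
open import Data.Bool using (Bool; true; false; if_then_else_)
open import Data.Vec as Vec using (Vec; tabulate; lookup; zipWith; replicate)
open import Data.Vec.Properties using (≡-dec)
open import Data.List as List using (List; []; _∷_; _∷ʳ_; length; map; foldr; allFin)
open import Data.Maybe using (Maybe; just; nothing)
open import Data.Product using (_×_; _,_)
open import Function.Bundles using (_↔_; Inverse)
open import Relation.Nullary using (¬_; yes; no)
open import Relation.Nullary.Decidable using (⌊_⌋)
open import Relation.Binary.PropositionalEquality using (_≡_; _≢_)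

Site : ℕ → Set
Site d = Vec ℤ d

origin : ∀ {d} → Site d
origin = replicate _ (+ 0)

_⊕_ : ∀ {d} → Site d → Site d → Site d
_⊕_ = zipWith ℤ._+_

_≟S_ : ∀ {d} (x y : Site d) → Relation.Nullary.Dec (x ≡ y)
_≟S_ = ≡-dec ℤ._≟_

-- Directions: (i , true) = +e_i ,  (i , false) = -e_i.
Dir : ℕ → Set
Dir d = Fin d × Bool

dirVec : ∀ {d} → Dir d → Site d
dirVec (i , s) = tabulate λ j → if ⌊ i Fin.≟ j ⌋ then (if s then + 1 else -[1+ 0 ]) else + 0

-- A total ordering of E_d = {±e_1,…,±e_d}: a bijection with positions 0,…,2d-1.
-- Inverse.to gives the position of a direction; Inverse.from j is ε_j.
Ordering : ℕ → Set
Ordering d = Dir d ↔ Fin (2 * d)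

pos : ∀ {d} → Ordering d → Dir d → Fin (2 * d)
pos ord = Inverse.to ord

ε : ∀ {d} → Ordering d → Fin (2 * d) → Dir d
ε ord = Inverse.from ord

ValidOrdering : ∀ {d} → Ordering d → Set
ValidOrdering {d} ord =
  (∀ (i j : Fin d) → i Fin.< j → pos ord (i , true) Fin.< pos ord (j , true))
  × (∀ (i : Fin d) → pos ord (i , true) Fin.< pos ord (i , false))

cyc : ∀ {k} → Fin k → Fin k
cyc {suc m} j with ℕ.suc (toℕ j) ℕ.<? suc m
... | yes p = fromℕ< p
... | no _  = zero

pos₀ : ∀ d → 1 ℕ.≤ d → Fin (2 * d)
pos₀ (suc m) _ = zero

-- Configuration: the rotor (as a position in the ordering) at each site,
-- `nothing` meaning unoccupied; plus the list of occupied sites (in order of occupation).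
record Config (d : ℕ) : Set where
  constructor config
  field
    rot : Site d → Maybe (Fin (2 * d))
    occ : List (Site d)
open Config public

update : ∀ {d} {A : Set} → (Site d → A) → Site d → A → Site d → A
update f x v y = if ⌊ y ≟S x ⌋ then v else f y

-- Walk ord z c x c' : a particle at x in configuration c ends, after moving
-- according to the rotor-router rule, with resulting configuration c'.
-- z is the position of ε_0 (the rotor given to a newly occupied site).
data Walk {d} (ord : Ordering d) (z : Fin (2 * d)) : Config d → Site d → Config d → Set where
  settle : ∀ {c x} → rot c x ≡ nothing →
           Walk ord z c x (config (update (rot c) x (just z)) (occ c ∷ʳ x))
  move   : ∀ {c x j c'} → rot c x ≡ just j →
           Walk ord z (config (update (rot c) x (just (cyc j))) (occ c))
                      (x ⊕ dirVec (ε ord j)) c' →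
           Walk ord z c x c'

data Reach {d} (ord : Ordering d) (d≥1 : 1 ℕ.≤ d) : ℕ → Config d → Set where
  start : Reach ord d≥1 0 (config (λ _ → nothing) [])
  add   : ∀ {n c c'} → Reach ord d≥1 n c → Walk ord (pos₀ d d≥1) c origin c' →
          Reach ord d≥1 (suc n) c'

sumℚ : List ℚ → ℚ
sumℚ = foldr ℚ._+_ 0ℚ

centerOfMass : ∀ {d} → List (Site d) → Fin d → ℚ
centerOfMass [] i = 0ℚ
centerOfMass (x ∷ xs) i =
  foldr ℤ._+_ (+ 0) (map (λ y → lookup y i) (x ∷ xs)) ℚ./ suc (length xs)

Arc : ∀ {d} → Ordering d → Fin d → Dir d → Set
Arc ord i δ = (pos ord (i , true) Fin.< pos ord δ) × (pos ord δ Fin.≤ pos ord (i , false))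

Coclique : ∀ {d} → Ordering d → Subset d → Set
Coclique {d} ord C = ∀ (i j : Fin d) → lookup C i ≡ true → lookup C j ≡ true → i ≢ j →
                     ∀ (δ : Dir d) → ¬ (Arc ord i δ × Arc ord j δ)

sumOver : ∀ {d} → Subset d → (Fin d → ℚ) → ℚ
sumOver {d} C f = sumℚ (map (λ i → if lookup C i then f i else 0ℚ) (allFin d))

module Submission where

-- Let h_i(ε) be 1 if e_i < ε ≤ -e_i and 0 otherwise. When a particle leaves a site along its
-- rotor ε_r and that rotor advances to ε_{r+1}, the value of h_i at the site changes by exactly
-- the i-th coordinate of ε_r; this uses only e_i < -e_i. A newly
-- occupied site gets ε_0, and h_i(ε_0) = 0. Hence, while a particle walks at x, the i-th
-- coordinates of the occupied sites plus x_i add up to the number of occupied sites whose rotor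
-- has h_i = 1. After n particles have settled, n c_i is therefore such a count, which lies in
-- [0, n]. The arcs of a coclique are disjoint, so each rotor is counted for at most one i ∈ C,
-- and n Σ_{i ∈ C} c_i ≤ n.

open import Defs
open import Data.Nat using (ℕ; _≤_)
open import Data.Fin using (Fin)
open import Data.Fin.Subset using (Subset)
open import Data.Rational using (0ℚ; 1ℚ) renaming (_≤_ to _≤ℚ_)
open import Data.Product using (_×_)

open import Data.Nat as ℕ using (suc; NonZero; z≤n; s≤s)
import Data.Nat.Properties as ℕP
open import Data.Nat.ListAction using (sum)
open import Data.Nat.Tactic.RingSolver as ℕSolver using ()
open import Data.Integer as ℤ using (ℤ; +_; -[1+_])
import Data.Integer.Properties as ℤP
open import Data.Integer.Tactic.RingSolver as ℤSolver using ()
open import Data.Rational as ℚ using (ℚ; _/_; toℚᵘ)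
open import Data.Rational.Properties
  using ( toℚᵘ-injective; toℚᵘ-fromℚᵘ; toℚᵘ-homo-+; toℚᵘ-cancel-≤
        ; nonNegative⁻¹; normalize-nonNeg; 0/n≡0)
open import Data.Rational.Unnormalised as ℚᵘ using (mkℚᵘ; *≡*; *≤*)
import Data.Rational.Unnormalised.Properties as ℚᵘP
open import Data.Fin as Fin using (toℕ)
import Data.Fin.Properties as FinP
open import Data.Bool using (true; false; if_then_else_)
open import Data.Maybe using (Maybe; just; nothing)
open import Data.Vec using (lookup)
import Data.Vec.Properties as VecP
open import Data.List using (List; []; _∷_; _++_; _∷ʳ_; length; map; foldr; allFin)
import Data.List.Properties as ListP
open import Data.List.Relation.Unary.All as All using (All; []; _∷_)
open import Data.List.Relation.Unary.AllPairs using (_∷_)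
open import Data.List.Relation.Unary.Unique.Propositional using (Unique)
open import Data.List.Relation.Unary.Unique.Propositional.Properties using (allFin⁺)
open import Data.Product using (_,_; proj₁; proj₂)
open import Data.Sum using (_⊎_; inj₁; inj₂)
open import Data.Empty using (⊥-elim)
open import Function using (_∘_; Inverse)
open import Relation.Nullary using (¬_; does; yes; no; contradiction; _×-dec_)
open import Relation.Nullary.Decidable using (⌊_⌋; dec-true; dec-false)
open import Relation.Binary.PropositionalEquality
open import Algebra.Properties.CommutativeSemigroup ℕP.+-commutativeSemigroup using (interchange)
open import Algebra.Properties.AbelianGroup ℤP.+-0-abelianGroup using (∙-cancelʳ)

+-distrib-/ : ∀ i j n .{{_ : NonZero n}} → (i ℤ.+ j) / n ≡ i / n ℚ.+ j / n
+-distrib-/ i j n@(suc k) = toℚᵘ-injective (begin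
  toℚᵘ ((i ℤ.+ j) / n)
    ≈⟨ toℚᵘ-fromℚᵘ (mkℚᵘ (i ℤ.+ j) k) ⟩
  mkℚᵘ (i ℤ.+ j) k
    ≈⟨ *≡* (distrib i j (+ n)) ⟩
  mkℚᵘ i k ℚᵘ.+ mkℚᵘ j k
    ≈⟨ ℚᵘP.+-cong (toℚᵘ-fromℚᵘ (mkℚᵘ i k)) (toℚᵘ-fromℚᵘ (mkℚᵘ j k)) ⟨
  toℚᵘ (i / n) ℚᵘ.+ toℚᵘ (j / n)
    ≈⟨ toℚᵘ-homo-+ (i / n) (j / n) ⟨
  toℚᵘ (i / n ℚ.+ j / n)
    ∎)
  where
  open ℚᵘP.≃-Reasoning
  distrib : ∀ a b m → (a ℤ.+ b) ℤ.* (m ℤ.* m) ≡ (a ℤ.* m ℤ.+ b ℤ.* m) ℤ.* m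
  distrib = ℤSolver.solve-∀

sumℚ-/ : ∀ {A : Set} (f : A → ℕ) n .{{_ : NonZero n}} (xs : List A) →
         sumℚ (map (λ x → + f x / n) xs) ≡ + sum (map f xs) / n
sumℚ-/ f n []       = sym (0/n≡0 n)
sumℚ-/ f n (x ∷ xs) = begin
  + f x / n ℚ.+ sumℚ (map (λ x → + f x / n) xs) ≡⟨ cong (+ f x / n ℚ.+_) (sumℚ-/ f n xs) ⟩
  + f x / n ℚ.+ + sum (map f xs) / n           ≡⟨ +-distrib-/ (+ f x) (+ sum (map f xs)) n ⟨
  (+ f x ℤ.+ + sum (map f xs)) / n             ≡⟨ cong (_/ n) (ℤP.pos-+ (f x) (sum (map f xs))) ⟨
  + sum (map f (x ∷ xs)) / n                   ∎
  where open ≡-Reasoning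

0≤m/n : ∀ m n .{{_ : NonZero n}} → 0ℚ ℚ.≤ + m / n
0≤m/n m n = nonNegative⁻¹ (+ m / n) {{normalize-nonNeg m n}}

m≤n⇒m/n≤1 : ∀ {m n} .{{_ : NonZero n}} → m ℕ.≤ n → + m / n ℚ.≤ 1ℚ
m≤n⇒m/n≤1 {m} {n@(suc k)} m≤n = toℚᵘ-cancel-≤
  (ℚᵘP.≤-respˡ-≃ (ℚᵘP.≃-sym (toℚᵘ-fromℚᵘ (mkℚᵘ (+ m) k)))
    (*≤* (subst₂ ℤ._≤_ (sym (ℤP.*-identityʳ (+ m))) (sym (ℤP.*-identityˡ (+ n))) (ℤ.+≤+ m≤n))))

cyc-view : ∀ {k} (r : Fin k) → toℕ (cyc r) ≡ suc (toℕ r) ⊎ (toℕ (cyc r) ≡ 0 × suc (toℕ r) ≡ k)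
cyc-view {suc m} r with suc (toℕ r) ℕ.<? suc m
... | yes r+1<k = inj₁ (FinP.toℕ-fromℕ< r+1<k)
... | no  r+1≮k = inj₂ (refl , ℕP.≤-antisym (FinP.toℕ<n r) (ℕP.≮⇒≥ r+1≮k))

window : ∀ {k} → Fin k → Fin k → Fin k → ℕ
window p q r = if does (p Fin.<? r ×-dec r Fin.≤? q) then 1 else 0

module _ {k} (p q : Fin k) where

  window-yes : ∀ {r} → p Fin.< r → r Fin.≤ q → window p q r ≡ 1
  window-yes {r} p<r r≤q rewrite dec-true (p Fin.<? r ×-dec r Fin.≤? q) (p<r , r≤q) = refl

  window-no : ∀ {r} → ¬ (p Fin.< r × r Fin.≤ q) → window p q r ≡ 0
  window-no {r} ¬p<r≤q rewrite dec-false (p Fin.<? r ×-dec r Fin.≤? q) ¬p<r≤q = refl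

  window-≤1 : ∀ r → window p q r ℕ.≤ 1
  window-≤1 r with does (p Fin.<? r ×-dec r Fin.≤? q)
  ... | true  = ℕP.≤-refl
  ... | false = z≤n

  window≡1⇒ : ∀ {r} → window p q r ≡ 1 → p Fin.< r × r Fin.≤ q
  window≡1⇒ {r} eq with p Fin.<? r ×-dec r Fin.≤? q
  ... | yes p<r≤q = p<r≤q
  ... | no ¬p<r≤q = contradiction (trans (sym eq) (window-no ¬p<r≤q)) λ ()

  window-at-lower : window p q p ≡ 0
  window-at-lower = window-no λ (p<p , _) → ℕP.<-irrefl refl p<p

  window-at-upper : p Fin.< q → window p q q ≡ 1
  window-at-upper p<q = window-yes p<q ℕP.≤-refl

  window-after-lower : p Fin.< q → window p q (cyc p) ≡ 1
  window-after-lower p<q with cyc-view p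
  ... | inj₁ eq       = window-yes (ℕP.≤-reflexive (sym eq)) (subst (ℕ._≤ toℕ q) (sym eq) p<q)
  ... | inj₂ (_ , eq) = ⊥-elim (ℕP.<-irrefl eq (ℕP.<-≤-trans (s≤s p<q) (FinP.toℕ<n q)))

  window-after-upper : p Fin.< q → window p q (cyc q) ≡ 0
  window-after-upper p<q with cyc-view q
  ... | inj₁ eq       = window-no λ (_ , q+1≤q) → ℕP.<-irrefl refl (subst (ℕ._≤ toℕ q) eq q+1≤q)
  ... | inj₂ (eq , _) = window-no λ (p<0 , _) → ℕP.n≮0 (subst (toℕ p ℕ.<_) eq p<0)

  window-cyc : ∀ {r} → r ≢ p → r ≢ q → window p q (cyc r) ≡ window p q r
  window-cyc {r} r≢p r≢q with cyc-view r | p Fin.<? r ×-dec r Fin.≤? q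
  ... | inj₁ eq | yes (p<r , r≤q) = trans
    (window-yes (subst (toℕ p ℕ.<_) (sym eq) (ℕP.m<n⇒m<1+n p<r))
                (subst (ℕ._≤ toℕ q) (sym eq) (ℕP.≤∧≢⇒< r≤q (r≢q ∘ FinP.toℕ-injective))))
    (sym (window-yes p<r r≤q))
  ... | inj₁ eq | no ¬p<r≤q = trans
    (window-no λ (p<r+1 , r+1≤q) → ¬p<r≤q
      ( ℕP.≤∧≢⇒< (ℕP.≤-pred (subst (toℕ p ℕ.<_) eq p<r+1)) (r≢p ∘ sym ∘ FinP.toℕ-injective)
      , ℕP.<⇒≤ (subst (ℕ._≤ toℕ q) eq r+1≤q)))
    (sym (window-no ¬p<r≤q))
  ... | inj₂ (eq , _) | no ¬p<r≤q = trans
    (window-no λ (p<0 , _) → ℕP.n≮0 (subst (toℕ p ℕ.<_) eq p<0))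
    (sym (window-no ¬p<r≤q))
  ... | inj₂ (_ , r+1≡k) | yes (_ , r≤q) = ⊥-elim (r≢q (FinP.toℕ-injective
    (ℕP.≤-antisym r≤q (ℕP.≤-pred (subst (toℕ q ℕ.<_) (sym r+1≡k) (FinP.toℕ<n q))))))

sum-map-∷ʳ : ∀ {A : Set} (g : A → ℕ) (xs : List A) x →
             sum (map g (xs ∷ʳ x)) ≡ sum (map g xs) ℕ.+ g x
sum-map-∷ʳ g []       x = ℕP.+-identityʳ (g x)
sum-map-∷ʳ g (y ∷ xs) x = trans (cong (g y ℕ.+_) (sum-map-∷ʳ g xs x)) (sym (ℕP.+-assoc (g y) _ _))

sum-map-+ : ∀ {A : Set} (f g : A → ℕ) (xs : List A) →
            sum (map (λ x → f x ℕ.+ g x) xs) ≡ sum (map f xs) ℕ.+ sum (map g xs)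
sum-map-+ f g []       = refl
sum-map-+ f g (x ∷ xs) rewrite sum-map-+ f g xs = interchange (f x) (g x) _ _

sum-map-≡0 : ∀ {A : Set} {g : A → ℕ} {xs : List A} → All (λ x → g x ≡ 0) xs → sum (map g xs) ≡ 0
sum-map-≡0 []            = refl
sum-map-≡0 (gx≡0 ∷ g≡0) rewrite gx≡0 = sum-map-≡0 g≡0

sum-map-≤-length : ∀ {A : Set} (g : A → ℕ) → (∀ x → g x ≤ 1) →
                   (xs : List A) → sum (map g xs) ≤ length xs
sum-map-≤-length g g≤1 []       = z≤n
sum-map-≤-length g g≤1 (x ∷ xs) = ℕP.+-mono-≤ (g≤1 x) (sum-map-≤-length g g≤1 xs)

sum-map-≤1 : ∀ {A : Set} (g : A → ℕ) → (∀ x → g x ≤ 1) →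
             (∀ x y → g x ≡ 1 → g y ≡ 1 → x ≡ y) →
             {xs : List A} → Unique xs → sum (map g xs) ≤ 1
sum-map-≤1 g g≤1 g-once {[]}     _            = z≤n
sum-map-≤1 g g≤1 g-once {x ∷ xs} (x∉xs ∷ uxs) with ℕP.n≤1⇒n≡0∨n≡1 (g≤1 x)
... | inj₁ gx≡0 rewrite gx≡0 = sum-map-≤1 g g≤1 g-once uxs
... | inj₂ gx≡1 = ℕP.≤-reflexive (cong₂ ℕ._+_ gx≡1 (sum-map-≡0 (All.map vanishes x∉xs)))
  where
  vanishes : ∀ {y} → x ≢ y → g y ≡ 0
  vanishes x≢y with ℕP.n≤1⇒n≡0∨n≡1 (g≤1 _)
  ... | inj₁ gy≡0 = gy≡0
  ... | inj₂ gy≡1 = contradiction (g-once _ _ gx≡1 gy≡1) x≢y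

module _ {d : ℕ} where

  occurrences : Site d → List (Site d) → ℕ
  occurrences x []       = 0
  occurrences x (y ∷ ys) = if ⌊ y ≟S x ⌋ then suc (occurrences x ys) else occurrences x ys

  occurrences-++ : ∀ x (ys zs : List (Site d)) →
                   occurrences x (ys ++ zs) ≡ occurrences x ys ℕ.+ occurrences x zs
  occurrences-++ x []       zs = refl
  occurrences-++ x (y ∷ ys) zs with y ≟S x
  ... | yes _ = cong suc (occurrences-++ x ys zs)
  ... | no  _ = occurrences-++ x ys zs

  update-same : ∀ {A : Set} (f : Site d → A) x v → update f x v x ≡ v
  update-same f x v with x ≟S x
  ... | yes _  = refl
  ... | no x≢x = contradiction refl x≢x

  sum-map-update : ∀ {A : Set} (g : A → ℕ) (f : Site d → A) x v ys →
    sum (map (g ∘ update f x v) ys) ℕ.+ occurrences x ys ℕ.* g (f x)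
      ≡ sum (map (g ∘ f) ys) ℕ.+ occurrences x ys ℕ.* g v
  sum-map-update g f x v []       = refl
  sum-map-update g f x v (y ∷ ys) with y ≟S x
  ... | yes refl = begin
    g v ℕ.+ s′ ℕ.+ suc k ℕ.* g (f x)
      ≡⟨ regroup (g v) (g (f x)) s′ (k ℕ.* g (f x)) ⟩
    (s′ ℕ.+ k ℕ.* g (f x)) ℕ.+ (g v ℕ.+ g (f x))
      ≡⟨ cong₂ ℕ._+_ (sum-map-update g f x v ys) (ℕP.+-comm (g v) (g (f x))) ⟩
    (s ℕ.+ k ℕ.* g v) ℕ.+ (g (f x) ℕ.+ g v)
      ≡⟨ regroup (g (f x)) (g v) s (k ℕ.* g v) ⟨
    g (f x) ℕ.+ s ℕ.+ suc k ℕ.* g v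
      ∎
    where
    open ≡-Reasoning
    s′ = sum (map (g ∘ update f x v) ys)
    s  = sum (map (g ∘ f) ys)
    k  = occurrences x ys
    regroup : ∀ a b t u → a ℕ.+ t ℕ.+ (b ℕ.+ u) ≡ (t ℕ.+ u) ℕ.+ (a ℕ.+ b)
    regroup = ℕSolver.solve-∀
  ... | no _ = trans (ℕP.+-assoc (g (f y)) _ _)
                     (trans (cong (g (f y) ℕ.+_) (sum-map-update g f x v ys))
                            (sym (ℕP.+-assoc (g (f y)) _ _)))

  module _ {A : Set} (g : A → ℕ) (f : Site d → A) (x : Site d) (v : A) (ys : List (Site d)) where

    private
      updated  = sum (map (g ∘ update f x v) ys)
      original = sum (map (g ∘ f) ys)
      with-occurrences : ∀ {k} → occurrences x ys ≡ k →
                         updated ℕ.+ k ℕ.* g (f x) ≡ original ℕ.+ k ℕ.* g v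
      with-occurrences refl = sum-map-update g f x v ys

    sum-map-update-absent : occurrences x ys ≡ 0 → updated ≡ original
    sum-map-update-absent x∉ys = begin
      updated        ≡⟨ ℕP.+-identityʳ updated ⟨
      updated ℕ.+ 0  ≡⟨ with-occurrences x∉ys ⟩
      original ℕ.+ 0 ≡⟨ ℕP.+-identityʳ original ⟩
      original       ∎
      where open ≡-Reasoning

    sum-map-update-once : occurrences x ys ≡ 1 → updated ℕ.+ g (f x) ≡ original ℕ.+ g v
    sum-map-update-once x∈ys = begin
      updated ℕ.+ g (f x)       ≡⟨ cong (updated ℕ.+_) (ℕP.*-identityˡ (g (f x))) ⟨
      updated ℕ.+ 1 ℕ.* g (f x) ≡⟨ with-occurrences x∈ys ⟩
      original ℕ.+ 1 ℕ.* g v    ≡⟨ cong (original ℕ.+_) (ℕP.*-identityˡ (g v)) ⟩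
      original ℕ.+ g v          ∎
      where open ≡-Reasoning

  coordSum : Fin d → List (Site d) → ℤ
  coordSum i ys = foldr ℤ._+_ (+ 0) (map (λ y → lookup y i) ys)

  coordSum-∷ʳ : ∀ i ys x → coordSum i (ys ∷ʳ x) ≡ coordSum i ys ℤ.+ lookup x i
  coordSum-∷ʳ i []       x = ℤP.+-comm (lookup x i) (+ 0)
  coordSum-∷ʳ i (y ∷ ys) x =
    trans (cong (ℤ._+_ (lookup y i)) (coordSum-∷ʳ i ys x)) (sym (ℤP.+-assoc (lookup y i) _ _))

walk-length : ∀ {d} {ord : Ordering d} {z c x c′} → Walk ord z c x c′ →
              length (occ c′) ≡ suc (length (occ c))
walk-length {c = c} (settle _) = trans (ListP.length-++ (occ c)) (ℕP.+-comm _ 1)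
walk-length (move _ w)         = walk-length w

reach-length : ∀ {d} {ord : Ordering d} {d≥1 n c} → Reach ord d≥1 n c → length (occ c) ≡ n
reach-length start     = refl
reach-length (add r w) = trans (walk-length w) (cong suc (reach-length r))

sumOverℕ : ∀ {d} → Subset d → (Fin d → ℕ) → ℕ
sumOverℕ {d} C a = sum (map (λ i → if lookup C i then a i else 0) (allFin d))

module _ {d : ℕ} (C : Subset d) where

  sumOverℕ-0 : sumOverℕ C (λ _ → 0) ≡ 0
  sumOverℕ-0 = sum-map-≡0 (All.universal (λ i → if-0 (lookup C i)) (allFin d))
    where
    if-0 : ∀ β → (if β then 0 else 0) ≡ 0
    if-0 true  = refl
    if-0 false = refl

  sumOverℕ-+ : ∀ a b → sumOverℕ C (λ i → a i ℕ.+ b i) ≡ sumOverℕ C a ℕ.+ sumOverℕ C b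
  sumOverℕ-+ a b = trans (cong sum (ListP.map-cong (λ i → if-+ (lookup C i) (a i) (b i)) (allFin d)))
                         (sum-map-+ _ _ (allFin d))
    where
    if-+ : ∀ β m n → (if β then m ℕ.+ n else 0) ≡ (if β then m else 0) ℕ.+ (if β then n else 0)
    if-+ true  m n = refl
    if-+ false m n = refl

  sumOverℕ-sum : ∀ {A : Set} (g : Fin d → A → ℕ) ys →
                 sumOverℕ C (λ i → sum (map (g i) ys)) ≡ sum (map (λ y → sumOverℕ C (λ i → g i y)) ys)
  sumOverℕ-sum g []       = sumOverℕ-0
  sumOverℕ-sum g (y ∷ ys) = trans (sumOverℕ-+ (λ i → g i y) (λ i → sum (map (g i) ys)))
                                  (cong (sumOverℕ C (λ i → g i y) ℕ.+_) (sumOverℕ-sum g ys))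

  sumOver-cong : ∀ {f g : Fin d → ℚ} → (∀ i → f i ≡ g i) → sumOver C f ≡ sumOver C g
  sumOver-cong f≗g =
    cong sumℚ (ListP.map-cong (λ i → cong (λ q → if lookup C i then q else 0ℚ) (f≗g i)) (allFin d))

  sumOver-/ : ∀ (a : Fin d → ℕ) n .{{_ : NonZero n}} →
              sumOver C (λ i → + a i / n) ≡ + sumOverℕ C a / n
  sumOver-/ a n = trans (cong sumℚ (ListP.map-cong (λ i → if-/ (lookup C i) (a i)) (allFin d)))
                        (sumℚ-/ (λ i → if lookup C i then a i else 0) n (allFin d))
    where
    if-/ : ∀ β m → (if β then + m / n else 0ℚ) ≡ + (if β then m else 0) / n
    if-/ true  m = refl
    if-/ false m = sym (0/n≡0 n)

module Rotors {d : ℕ} (ord : Ordering d) where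

  arcIndicator : Fin d → Maybe (Fin (2 ℕ.* d)) → ℕ
  arcIndicator i nothing  = 0
  arcIndicator i (just r) = window (pos ord (i , true)) (pos ord (i , false)) r

  rotorSum : Fin d → (Site d → Maybe (Fin (2 ℕ.* d))) → List (Site d) → ℕ
  rotorSum i f ys = sum (map (arcIndicator i ∘ f) ys)

  pos-injective : ∀ {δ δ′} → pos ord δ ≡ pos ord δ′ → δ ≡ δ′
  pos-injective {δ} {δ′} eq = begin
    δ                  ≡⟨ Inverse.strictlyInverseʳ ord δ ⟨
    ε ord (pos ord δ)  ≡⟨ cong (ε ord) eq ⟩
    ε ord (pos ord δ′) ≡⟨ Inverse.strictlyInverseʳ ord δ′ ⟩
    δ′                 ∎
    where open ≡-Reasoning

  dirVec-coord : ∀ i′ s i →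
                 lookup (dirVec (i′ , s)) i ≡ (if ⌊ i′ Fin.≟ i ⌋ then (if s then + 1 else -[1+ 0 ]) else + 0)
  dirVec-coord i′ s = VecP.lookup∘tabulate {n = d} _

  dirVec-same : ∀ i s → lookup (dirVec (i , s)) i ≡ (if s then + 1 else -[1+ 0 ])
  dirVec-same i s rewrite dirVec-coord i s i with i Fin.≟ i
  ... | yes _  = refl
  ... | no i≢i = contradiction refl i≢i

  dirVec-other : ∀ {i′ i} s → i′ ≢ i → lookup (dirVec (i′ , s)) i ≡ + 0
  dirVec-other {i′} {i} s i′≢i rewrite dirVec-coord i′ s i with i′ Fin.≟ i
  ... | yes i′≡i = contradiction i′≡i i′≢i
  ... | no _     = refl

  arcIndicator-cyc : ∀ {i} → pos ord (i , true) Fin.< pos ord (i , false) → ∀ r →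
                     + arcIndicator i (just (cyc r)) ≡ + arcIndicator i (just r) ℤ.+ lookup (dirVec (ε ord r)) i
  arcIndicator-cyc {i} e<-e r = step (ε ord r) r (Inverse.strictlyInverseˡ ord r)
    where
    p = pos ord (i , true)
    q = pos ord (i , false)
    step : ∀ δ r → pos ord δ ≡ r →
           + arcIndicator i (just (cyc r)) ≡ + arcIndicator i (just r) ℤ.+ lookup (dirVec δ) i
    step (i′ , s) r refl with i′ Fin.≟ i
    step (_ , true)  _ refl | yes refl = trans
      (cong +_ (window-after-lower p q e<-e))
      (sym (cong₂ (λ a b → + a ℤ.+ b) (window-at-lower p q) (dirVec-same i true)))
    step (_ , false) _ refl | yes refl = trans
      (cong +_ (window-after-upper p q e<-e))
      (sym (cong₂ (λ a b → + a ℤ.+ b) (window-at-upper p q e<-e) (dirVec-same i false)))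
    step (i′ , s) _ refl | no i′≢i = begin
      + window p q (cyc r′)            ≡⟨ cong +_ (window-cyc p q r′≢ r′≢) ⟩
      + window p q r′                  ≡⟨ ℤP.+-identityʳ _ ⟨
      + window p q r′ ℤ.+ + 0          ≡⟨ cong (ℤ._+_ (+ window p q r′)) (dirVec-other s i′≢i) ⟨
      + window p q r′ ℤ.+ lookup (dirVec (i′ , s)) i ∎
      where
      open ≡-Reasoning
      r′ = pos ord (i′ , s)
      r′≢ : ∀ {b} → r′ ≢ pos ord (i , b)
      r′≢ = i′≢i ∘ cong proj₁ ∘ pos-injective

  ε₀-outside : ∀ d≥1 i → arcIndicator i (just (pos₀ d d≥1)) ≡ 0
  ε₀-outside (s≤s z≤n) i = window-no (pos ord (i , true)) (pos ord (i , false)) λ (p<0 , _) → ℕP.n≮0 p<0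

  occupied : Maybe (Fin (2 ℕ.* d)) → ℕ
  occupied nothing  = 0
  occupied (just _) = 1

  ListsOccupied : Config d → Set
  ListsOccupied c = ∀ y → occurrences y (occ c) ≡ occupied (rot c y)

  Balanced : Config d → Site d → Set
  Balanced c x = ∀ i → coordSum i (occ c) ℤ.+ lookup x i ≡ + rotorSum i (rot c) (occ c)

  module _ {c : Config d} {x : Site d} (listed : ListsOccupied c) where

    settle-listed : ∀ {z} → rot c x ≡ nothing →
                    ListsOccupied (config (update (rot c) x (just z)) (occ c ∷ʳ x))
    settle-listed x-free y rewrite occurrences-++ y (occ c) (x ∷ []) with y ≟S x | x ≟S y
    ... | yes refl | yes _   = cong (ℕ._+ 1) (trans (listed y) (cong occupied x-free))
    ... | yes refl | no x≢x  = contradiction refl x≢x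
    ... | no y≢x   | yes x≡y = contradiction (sym x≡y) y≢x
    ... | no _     | no _    = trans (ℕP.+-identityʳ _) (listed y)

    settle-balanced : ∀ {z} → (∀ i → arcIndicator i (just z) ≡ 0) →
                      rot c x ≡ nothing → Balanced c x →
                      Balanced (config (update (rot c) x (just z)) (occ c ∷ʳ x)) origin
    settle-balanced {z} z-outside x-free balanced i = begin
      coordSum i (occ c ∷ʳ x) ℤ.+ lookup origin i
        ≡⟨ cong (ℤ._+_ (coordSum i (occ c ∷ʳ x))) (VecP.lookup-replicate i (+ 0)) ⟩
      coordSum i (occ c ∷ʳ x) ℤ.+ + 0 ≡⟨ ℤP.+-identityʳ _ ⟩
      coordSum i (occ c ∷ʳ x)         ≡⟨ coordSum-∷ʳ i (occ c) x ⟩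
      coordSum i (occ c) ℤ.+ lookup x i ≡⟨ balanced i ⟩
      + rotorSum i (rot c) (occ c)    ≡⟨ cong +_ rotorSum-settle ⟨
      + rotorSum i f′ (occ c ∷ʳ x)    ∎
      where
      open ≡-Reasoning
      f′ = update (rot c) x (just z)
      rotorSum-settle : rotorSum i f′ (occ c ∷ʳ x) ≡ rotorSum i (rot c) (occ c)
      rotorSum-settle = begin
        rotorSum i f′ (occ c ∷ʳ x)
          ≡⟨ sum-map-∷ʳ (arcIndicator i ∘ f′) (occ c) x ⟩
        rotorSum i f′ (occ c) ℕ.+ arcIndicator i (f′ x)
          ≡⟨ cong₂ ℕ._+_
               (sum-map-update-absent (arcIndicator i) (rot c) x (just z) (occ c)
                  (trans (listed x) (cong occupied x-free)))
               (trans (cong (arcIndicator i) (update-same (rot c) x (just z))) (z-outside i)) ⟩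
        rotorSum i (rot c) (occ c) ℕ.+ 0
          ≡⟨ ℕP.+-identityʳ _ ⟩
        rotorSum i (rot c) (occ c)
          ∎

    move-listed : ∀ {j} → rot c x ≡ just j →
                  ListsOccupied (config (update (rot c) x (just (cyc j))) (occ c))
    move-listed x-holds y with y ≟S x
    ... | yes refl = trans (listed y) (cong occupied x-holds)
    ... | no _     = listed y

    move-balanced : (∀ i → pos ord (i , true) Fin.< pos ord (i , false)) →
                    ∀ {j} → rot c x ≡ just j → Balanced c x →
                    Balanced (config (update (rot c) x (just (cyc j))) (occ c)) (x ⊕ dirVec (ε ord j))
    move-balanced e<-e {j} x-holds balanced i = ∙-cancelʳ (+ h) _ _ (begin
      (S ℤ.+ lookup (x ⊕ dirVec (ε ord j)) i) ℤ.+ + h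
        ≡⟨ cong (λ t → (S ℤ.+ t) ℤ.+ + h) (VecP.lookup-zipWith ℤ._+_ i x (dirVec (ε ord j))) ⟩
      (S ℤ.+ (X ℤ.+ D)) ℤ.+ + h ≡⟨ regroup S X D (+ h) ⟩
      (S ℤ.+ X) ℤ.+ (+ h ℤ.+ D) ≡⟨ cong₂ ℤ._+_ (balanced i) (sym (arcIndicator-cyc (e<-e i) j)) ⟩
      + R ℤ.+ + h′              ≡⟨ ℤP.pos-+ R h′ ⟨
      + (R ℕ.+ h′)              ≡⟨ cong +_ rotorSum-move ⟨
      + (R₁ ℕ.+ h)              ≡⟨ ℤP.pos-+ R₁ h ⟩
      + R₁ ℤ.+ + h              ∎)
      where
      open ≡-Reasoning
      S  = coordSum i (occ c)
      X  = lookup x i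
      D  = lookup (dirVec (ε ord j)) i
      h  = arcIndicator i (just j)
      h′ = arcIndicator i (just (cyc j))
      R  = rotorSum i (rot c) (occ c)
      R₁ = rotorSum i (update (rot c) x (just (cyc j))) (occ c)
      regroup : ∀ a b e u → (a ℤ.+ (b ℤ.+ e)) ℤ.+ u ≡ (a ℤ.+ b) ℤ.+ (u ℤ.+ e)
      regroup = ℤSolver.solve-∀
      rotorSum-move : R₁ ℕ.+ h ≡ R ℕ.+ h′
      rotorSum-move = subst (λ m → R₁ ℕ.+ arcIndicator i m ≡ R ℕ.+ h′) x-holds
        (sum-map-update-once (arcIndicator i) (rot c) x (just (cyc j)) (occ c)
          (trans (listed x) (cong occupied x-holds)))

  module _ (e<-e : ∀ i → pos ord (i , true) Fin.< pos ord (i , false)) where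

    walk-invariant : ∀ {z} → (∀ i → arcIndicator i (just z) ≡ 0) →
                     ∀ {c x c′} → Walk ord z c x c′ →
                     ListsOccupied c → Balanced c x → ListsOccupied c′ × Balanced c′ origin
    walk-invariant z-outside {c} {x} (settle x-free) listed balanced =
      settle-listed {c} {x} listed x-free , settle-balanced {c} {x} listed z-outside x-free balanced
    walk-invariant z-outside {c} {x} (move x-holds w) listed balanced =
      walk-invariant z-outside w (move-listed {c} {x} listed x-holds)
                                 (move-balanced {c} {x} listed e<-e x-holds balanced)

    reach-invariant : ∀ {d≥1 n c} → Reach ord d≥1 n c → ListsOccupied c × Balanced c origin
    reach-invariant start =
      (λ _ → refl) , (λ i → trans (ℤP.+-identityˡ (lookup origin i)) (VecP.lookup-replicate i (+ 0)))
    reach-invariant {d≥1} (add r w) with reach-invariant r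
    ... | listed , balanced = walk-invariant (ε₀-outside d≥1) w listed balanced

    reach-coordSum : ∀ {d≥1 n c} → Reach ord d≥1 n c →
                     ∀ i → coordSum i (occ c) ≡ + rotorSum i (rot c) (occ c)
    reach-coordSum {c = c} reach i = begin
      coordSum i (occ c)
        ≡⟨ ℤP.+-identityʳ _ ⟨
      coordSum i (occ c) ℤ.+ + 0
        ≡⟨ cong (ℤ._+_ (coordSum i (occ c))) (VecP.lookup-replicate i (+ 0)) ⟨
      coordSum i (occ c) ℤ.+ lookup origin i
        ≡⟨ proj₂ (reach-invariant reach) i ⟩
      + rotorSum i (rot c) (occ c)
        ∎
      where open ≡-Reasoning

  arcIndicator-≤1 : ∀ i m → arcIndicator i m ≤ 1
  arcIndicator-≤1 i nothing  = z≤n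
  arcIndicator-≤1 i (just r) = window-≤1 (pos ord (i , true)) (pos ord (i , false)) r

  arcIndicator≡1⇒Arc : ∀ i r → arcIndicator i (just r) ≡ 1 → Arc ord i (ε ord r)
  arcIndicator≡1⇒Arc i r eq =
    subst (λ t → pos ord (i , true) Fin.< t × t Fin.≤ pos ord (i , false))
          (sym (Inverse.strictlyInverseˡ ord r))
          (window≡1⇒ (pos ord (i , true)) (pos ord (i , false)) eq)

  coclique-arc-unique : ∀ {C} → Coclique ord C → ∀ {i j} m → lookup C i ≡ true → lookup C j ≡ true →
                        arcIndicator i m ≡ 1 → arcIndicator j m ≡ 1 → i ≡ j
  coclique-arc-unique coclique nothing _ _ () _
  coclique-arc-unique coclique {i} {j} (just r) Ci Cj i∈arc j∈arc with i Fin.≟ j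
  ... | yes i≡j = i≡j
  ... | no i≢j  = contradiction (arcIndicator≡1⇒Arc i r i∈arc , arcIndicator≡1⇒Arc j r j∈arc)
                                (coclique i j Ci Cj i≢j (ε ord r))

  arcIndicator-coclique : ∀ {C} → Coclique ord C → ∀ m → sumOverℕ C (λ i → arcIndicator i m) ≤ 1
  arcIndicator-coclique {C} coclique m = sum-map-≤1 g g≤1 g-once (allFin⁺ d)
    where
    g : Fin d → ℕ
    g i = if lookup C i then arcIndicator i m else 0
    g≤1 : ∀ i → g i ≤ 1
    g≤1 i with lookup C i
    ... | true  = arcIndicator-≤1 i m
    ... | false = z≤n
    g-once : ∀ i j → g i ≡ 1 → g j ≡ 1 → i ≡ j
    g-once i j gi≡1 gj≡1 with lookup C i in Ci | lookup C j in Cj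
    g-once i j gi≡1 gj≡1 | true  | true  = coclique-arc-unique {C} coclique m Ci Cj gi≡1 gj≡1
    g-once i j ()   _    | false | _
    g-once i j _    ()   | true  | false

  rotorSum-≤-length : ∀ i f ys → rotorSum i f ys ≤ length ys
  rotorSum-≤-length i f = sum-map-≤-length (arcIndicator i ∘ f) (arcIndicator-≤1 i ∘ f)

  coclique-rotorSum-≤-length : ∀ {C} → Coclique ord C → ∀ f ys →
                               sumOverℕ C (λ i → rotorSum i f ys) ≤ length ys
  coclique-rotorSum-≤-length {C} coclique f ys = begin
    sumOverℕ C (λ i → rotorSum i f ys)
      ≡⟨ sumOverℕ-sum C (λ i y → arcIndicator i (f y)) ys ⟩
    sum (map (λ y → sumOverℕ C (λ i → arcIndicator i (f y))) ys)
      ≤⟨ sum-map-≤-length _ (arcIndicator-coclique {C} coclique ∘ f) ys ⟩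
    length ys
      ∎
    where open ℕP.≤-Reasoning

  centerOfMass-bounds : ∀ f (ys : List (Site d)) → 1 ≤ length ys →
    (∀ i → coordSum i ys ≡ + rotorSum i f ys) →
    ((i : Fin d) → (0ℚ ≤ℚ centerOfMass ys i) × (centerOfMass ys i ≤ℚ 1ℚ))
    × ((C : Subset d) → Coclique ord C → sumOver C (centerOfMass ys) ≤ℚ 1ℚ)
  centerOfMass-bounds f ys@(_ ∷ _) _ coords = coordinate-bounds , coclique-bound
    where
    n = length ys
    centre : ∀ i → centerOfMass ys i ≡ + rotorSum i f ys / n
    centre i = cong (_/ n) (coords i)
    coordinate-bounds : (i : Fin d) → (0ℚ ≤ℚ centerOfMass ys i) × (centerOfMass ys i ≤ℚ 1ℚ)
    coordinate-bounds i = subst (0ℚ ≤ℚ_) (sym (centre i)) (0≤m/n (rotorSum i f ys) n)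
                        , subst (_≤ℚ 1ℚ) (sym (centre i)) (m≤n⇒m/n≤1 (rotorSum-≤-length i f ys))
    coclique-bound : (C : Subset d) → Coclique ord C → sumOver C (centerOfMass ys) ≤ℚ 1ℚ
    coclique-bound C coclique =
      subst (_≤ℚ 1ℚ) (sym (trans (sumOver-cong C centre) (sumOver-/ C (λ i → rotorSum i f ys) n)))
            (m≤n⇒m/n≤1 (coclique-rotorSum-≤-length {C} coclique f ys))

theorem4p1 : (d : ℕ) (d≥1 : 1 ≤ d) (ord : Ordering d) → ValidOrdering ord →
    (n : ℕ) → 1 ≤ n → (c : Config d) → Reach ord d≥1 n c →
    ((i : Fin d) → (0ℚ ≤ℚ centerOfMass (occ c) i) × (centerOfMass (occ c) i ≤ℚ 1ℚ))
    × ((C : Subset d) → Coclique ord C → sumOver C (centerOfMass (occ c)) ≤ℚ 1ℚ)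
theorem4p1 d d≥1 ord (_ , e<-e) n n≥1 c reach =
  centerOfMass-bounds (rot c) (occ c) (subst (1 ≤_) (sym (reach-length reach)) n≥1) (reach-coordSum e<-e reach)
  where open Rotors ord
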